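{- Let $p$ be a prime, $n\ge2$, $q=p^n$, and $d=(d_0,d_1,\dots,d_{n-1})_p$. If $d\equiv r\pmod{p-1}$ with $2\le r\le p-1$ and $d_i\ge r$ for all $i\in\{0,\dots,n-1\}$, then there exists a positive integer $e\le q-1$ such that \[ s_p(e\star d)-s_p(e)>\frac{n(p-1)}{2}. \]
   Context: $(d_0,\dots,d_{n-1})_p$ denotes the integer $\sum_{i=0}^{n-1}d_ip^i$ where each $d_i\in\{0,\dots,p-1\}$ and not all $d_i$ equal $p-1$ (its base-$p$ representation). $s_p(e)$ is the base-$p$ digit sum of $e$. The operation $\star$ on $\{0,\dots,q-1\}$: $e\star d=0$ if $0\in\{e,d\}$; otherwise, with $r'$ the unique integer in $[0,q-1)$ congruent to $ed$ modulo $q-1$, $e\star d=q-1$ if $r'=0$ and $e\star d=r'$ otherwise. -}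

module Defs where

open import Data.Nat using (ℕ; zero; suc; _+_; _*_; _∸_; _^_; NonZero; _≡ᵇ_)
open import Data.Nat.DivMod using (_/_; _%_)
open import Data.Fin using (Fin; toℕ)
open import Data.Bool using (if_then_else_; _∨_)

digitsValue : (p n : ℕ) → (Fin n → ℕ) → ℕ
digitsValue p zero    d = 0
digitsValue p (suc n) d = d Fin.zero + p * digitsValue p n (λ i → d (Fin.suc i))
  where import Data.Fin as Fin

-- base-p digit sum, with fuel (fuel = e suffices when p ≥ 2)
digitSumFuel : (fuel p : ℕ) → .{{NonZero p}} → ℕ → ℕ
digitSumFuel zero       p e = 0
digitSumFuel (suc fuel) p e = e % p + digitSumFuel fuel p (e / p)

s : (p : ℕ) → .{{NonZero p}} → ℕ → ℕ
s p e = digitSumFuel e p e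

star : (q : ℕ) → .{{NonZero (q ∸ 1)}} → ℕ → ℕ → ℕ
star q e d =
  if (e ≡ᵇ 0) ∨ (d ≡ᵇ 0) then 0
  else (let r′ = (e * d) % (q ∸ 1) in if r′ ≡ᵇ 0 then q ∸ 1 else r′)

{-# OPTIONS --safe #-}
-- Write p = k + 1, M = p^n − 1 and u = (1,…,1)_p, so that u·k = M.  Since D ≡ r (mod k),
-- u·D ≡ r·u (mod M), hence e = u − 1 = (0,1,…,1)_p satisfies e ⋆ D = F, where
-- F = (k + r − d_0, …, k + r − d_{n−1})_p is a genuine base-p expansion because r ≤ d_i ≤ k.
-- Then s_p(F) + s_p(D) = n(k + r) ≥ n(k + 2), so either e = 1 already works (s_p(D) is large)
-- or e = u − 1 does, having s_p(e) = n − 1.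
module Submission where

open import Defs
open import Data.Fin using (Fin; zero; suc)
open import Data.Nat
  using (ℕ; zero; suc; _+_; _*_; _∸_; _^_; _≤_; _<_; NonZero; s≤s; s≤s⁻¹; z≤n; _<?_)
open import Data.Nat.Divisibility using (n∣m*n)
open import Data.Nat.DivMod
open import Data.Nat.Primality using (Prime)
open import Data.Nat.Properties
open import Algebra.Properties.CommutativeMonoid.Sum +-0-commutativeMonoid
  using (sum; sum-cong-≗; ∑-distrib-+)
open import Algebra.Properties.CommutativeSemigroup +-commutativeSemigroup using (xy∙z≈xz∙y)
open import Data.Nat.Tactic.RingSolver using (solve-∀)
open import Data.Product using (Σ; _×_; _,_)
open import Data.Sum using (_⊎_; inj₁; inj₂)
open import Data.Vec.Functional using (Vector; _∷_; replicate)
open import Function using (_∘_)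
open import Relation.Binary.PropositionalEquality
open import Relation.Nullary using (¬_; yes; no; contradiction)

sum-replicate : ∀ n c → sum (replicate n c) ≡ n * c
sum-replicate zero    c = refl
sum-replicate (suc n) c = cong (c +_) (sum-replicate n c)

sum-complement : ∀ n c (f : Vector ℕ n) → (∀ i → f i ≤ c) →
                 sum (λ i → c ∸ f i) + sum f ≡ n * c
sum-complement n c f f≤c = begin
  sum (λ i → c ∸ f i) + sum f ≡⟨ ∑-distrib-+ (λ i → c ∸ f i) f ⟨
  sum (λ i → c ∸ f i + f i)   ≡⟨ sum-cong-≗ (m∸n+n≡m ∘ f≤c) ⟩
  sum (replicate n c)         ≡⟨ sum-replicate n c ⟩
  n * c                       ∎
  where open ≡-Reasoning

repunit : ℕ → ℕ → ℕ
repunit p n = digitsValue p n (replicate n 1)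

-- (0,1,…,1)_p = p · repunit p n; its successor is definitionally repunit p (suc n).
shiftedRepunit : ℕ → ℕ → ℕ
shiftedRepunit p n = digitsValue p (suc n) (0 ∷ replicate n 1)

module _ (p : ℕ) where

  digitsValue-+ : ∀ n (f g : Vector ℕ n) →
                  digitsValue p n (λ i → f i + g i) ≡ digitsValue p n f + digitsValue p n g
  digitsValue-+ zero    f g = refl
  digitsValue-+ (suc n) f g =
    trans (cong (λ x → f zero + g zero + p * x) (digitsValue-+ n (f ∘ suc) (g ∘ suc)))
          (interchange (f zero) (g zero) p _ _)
    where
    interchange : ∀ a b p x y → a + b + p * (x + y) ≡ (a + p * x) + (b + p * y)
    interchange = solve-∀

  digitsValue-cong : ∀ n {f g : Vector ℕ n} → f ≗ g → digitsValue p n f ≡ digitsValue p n g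
  digitsValue-cong zero    f≗g = refl
  digitsValue-cong (suc n) f≗g =
    cong₂ (λ a x → a + p * x) (f≗g zero) (digitsValue-cong n (f≗g ∘ suc))

  digitsValue-mono : ∀ n {f g : Vector ℕ n} → (∀ i → f i ≤ g i) →
                     digitsValue p n f ≤ digitsValue p n g
  digitsValue-mono zero    f≤g = z≤n
  digitsValue-mono (suc n) f≤g =
    +-mono-≤ (f≤g zero) (*-monoʳ-≤ p (digitsValue-mono n (f≤g ∘ suc)))

  digitsValue-replicate : ∀ n c → digitsValue p n (replicate n c) ≡ c * repunit p n
  digitsValue-replicate zero    c = sym (*-zeroʳ c)
  digitsValue-replicate (suc n) c =
    trans (cong (λ x → c + p * x) (digitsValue-replicate n c)) (factor c p (repunit p n))
    where
    factor : ∀ c p u → c + p * (c * u) ≡ c * (1 + p * u)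
    factor = solve-∀

  digitsValue-complement : ∀ n c (f : Vector ℕ n) → (∀ i → f i ≤ c) →
                           digitsValue p n (λ i → c ∸ f i) + digitsValue p n f ≡ c * repunit p n
  digitsValue-complement n c f f≤c = begin
    digitsValue p n (λ i → c ∸ f i) + digitsValue p n f ≡⟨ digitsValue-+ n (λ i → c ∸ f i) f ⟨
    digitsValue p n (λ i → c ∸ f i + f i)               ≡⟨ digitsValue-cong n (m∸n+n≡m ∘ f≤c) ⟩
    digitsValue p n (replicate n c)                     ≡⟨ digitsValue-replicate n c ⟩
    c * repunit p n                                     ∎
    where open ≡-Reasoning

  module _ .{{_ : NonZero p}} where

    digit≤digitsValue : ∀ n (f : Vector ℕ n) i → f i ≤ digitsValue p n f
    digit≤digitsValue (suc n) f zero    = m≤m+n (f zero) _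
    digit≤digitsValue (suc n) f (suc i) =
      ≤-trans (digit≤digitsValue n (f ∘ suc) i) (≤-trans (m≤n*m _ p) (m≤n+m _ (f zero)))

    sum≤digitsValue : ∀ n (f : Vector ℕ n) → sum f ≤ digitsValue p n f
    sum≤digitsValue zero    f = z≤n
    sum≤digitsValue (suc n) f =
      +-monoʳ-≤ (f zero) (≤-trans (sum≤digitsValue n (f ∘ suc)) (m≤n*m _ p))

    digitSumFuel-0 : ∀ fuel → digitSumFuel fuel p 0 ≡ 0
    digitSumFuel-0 zero       = refl
    digitSumFuel-0 (suc fuel) =
      cong₂ _+_ (m*n%n≡0 0 p) (trans (cong (digitSumFuel fuel p) (0/n≡0 p)) (digitSumFuel-0 fuel))

digitsValue-maxDigit : ∀ k n → suc (digitsValue (suc k) n (replicate n k)) ≡ suc k ^ n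
digitsValue-maxDigit k zero    = refl
digitsValue-maxDigit k (suc n) =
  trans (step k (digitsValue (suc k) n (replicate n k))) (cong (suc k *_) (digitsValue-maxDigit k n))
  where
  step : ∀ k x → suc (k + suc k * x) ≡ suc k * suc x
  step = solve-∀

digitsValue≤pow∸1 : ∀ k n (f : Vector ℕ n) → (∀ i → f i ≤ k) →
                    digitsValue (suc k) n f ≤ suc k ^ n ∸ 1
digitsValue≤pow∸1 k n f f≤k =
  ≤-trans (digitsValue-mono (suc k) n f≤k) (≤-reflexive (cong (_∸ 1) (digitsValue-maxDigit k n)))

repunit*k≡pow∸1 : ∀ k n → repunit (suc k) n * k ≡ suc k ^ n ∸ 1
repunit*k≡pow∸1 k n = begin
  repunit (suc k) n * k                 ≡⟨ *-comm (repunit (suc k) n) k ⟩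
  k * repunit (suc k) n                 ≡⟨ digitsValue-replicate (suc k) n k ⟨
  digitsValue (suc k) n (replicate n k) ≡⟨ cong (_∸ 1) (digitsValue-maxDigit k n) ⟩
  suc k ^ n ∸ 1                         ∎
  where open ≡-Reasoning

module _ {p : ℕ} .{{_ : NonZero p}} (1<p : 1 < p) where

  private
    digit-% : ∀ {a} b → a < p → (a + p * b) % p ≡ a
    digit-% {a} b a<p = begin
      (a + p * b) % p ≡⟨ cong (λ x → (a + x) % p) (*-comm p b) ⟩
      (a + b * p) % p ≡⟨ [m+kn]%n≡m%n a b p ⟩
      a % p           ≡⟨ m<n⇒m%n≡m a<p ⟩
      a               ∎
      where open ≡-Reasoning

    digit-/ : ∀ {a} b → a < p → (a + p * b) / p ≡ b
    digit-/ {a} b a<p = begin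
      (a + p * b) / p   ≡⟨ cong (λ x → (a + x) / p) (*-comm p b) ⟩
      (a + b * p) / p   ≡⟨ +-distrib-/-∣ʳ a (n∣m*n b) ⟩
      a / p + b * p / p ≡⟨ cong₂ _+_ (m<n⇒m/n≡0 a<p) (m*n/n≡m b p) ⟩
      b                 ∎
      where open ≡-Reasoning

    quotient≤fuel : ∀ a b fuel → a + p * b ≤ suc fuel → b ≤ fuel
    quotient≤fuel a zero      fuel _       = z≤n
    quotient≤fuel a b@(suc _) fuel ≤1+fuel = s≤s⁻¹ (begin-strict
      b         <⟨ m<m*n b p 1<p ⟩
      b * p     ≡⟨ *-comm b p ⟩
      p * b     ≤⟨ m≤n+m _ a ⟩
      a + p * b ≤⟨ ≤1+fuel ⟩
      suc fuel  ∎)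
      where open ≤-Reasoning

  digitSumFuel-digitsValue : ∀ n (f : Vector ℕ n) → (∀ i → f i < p) →
                             ∀ fuel → digitsValue p n f ≤ fuel →
                             digitSumFuel fuel p (digitsValue p n f) ≡ sum f
  digitSumFuel-digitsValue zero    f f<p fuel       _  = digitSumFuel-0 p fuel
  digitSumFuel-digitsValue (suc n) f f<p zero       ≤0 =
    sym (n≤0⇒n≡0 (≤-trans (sum≤digitsValue p (suc n) f) ≤0))
  digitSumFuel-digitsValue (suc n) f f<p (suc fuel) ≤1+fuel
    rewrite digit-% (digitsValue p n (f ∘ suc)) (f<p zero)
          | digit-/ (digitsValue p n (f ∘ suc)) (f<p zero) =
    cong (f zero +_)
      (digitSumFuel-digitsValue n (f ∘ suc) (f<p ∘ suc) fuel (quotient≤fuel (f zero) _ fuel ≤1+fuel))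

  s-digitsValue : ∀ n (f : Vector ℕ n) → (∀ i → f i < p) → s p (digitsValue p n f) ≡ sum f
  s-digitsValue n f f<p = digitSumFuel-digitsValue n f f<p _ ≤-refl

  s-1 : s p 1 ≡ 1
  s-1 = trans (+-identityʳ (1 % p)) (m<n⇒m%n≡m 1<p)

  s-shiftedRepunit : ∀ n → s p (shiftedRepunit p n) ≡ n
  s-shiftedRepunit n = begin
    s p (shiftedRepunit p n) ≡⟨ s-digitsValue (suc n) (0 ∷ replicate n 1) digit<p ⟩
    sum (replicate n 1)      ≡⟨ sum-replicate n 1 ⟩
    n * 1                    ≡⟨ *-identityʳ n ⟩
    n                        ∎
    where
    open ≡-Reasoning
    digit<p : ∀ i → (0 ∷ replicate n 1) i < p
    digit<p zero    = ≤-trans (s≤s z≤n) 1<p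
    digit<p (suc i) = 1<p

1≤shiftedRepunit : ∀ p .{{_ : NonZero p}} n → 1 ≤ shiftedRepunit p (suc n)
1≤shiftedRepunit p n = digit≤digitsValue p (suc (suc n)) (0 ∷ replicate (suc n) 1) (suc zero)

shiftedRepunit<pow∸1 : ∀ k .{{_ : NonZero k}} n → shiftedRepunit (suc k) n < suc k ^ suc n ∸ 1
shiftedRepunit<pow∸1 k n =
  ≤-trans (m≤m*n (repunit (suc k) (suc n)) k) (≤-reflexive (repunit*k≡pow∸1 k (suc n)))

star-unique : ∀ q .{{_ : NonZero (q ∸ 1)}} {e x t} → 1 ≤ e → 1 ≤ x → 1 ≤ t → t ≤ q ∸ 1 →
              (e * x) % (q ∸ 1) ≡ t % (q ∸ 1) → star q e x ≡ t
star-unique q {suc e} {suc x} {suc t} _ _ _ t≤M ex≡t with m≤n⇒m<n∨m≡n t≤M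
... | inj₁ t<M rewrite ex≡t | m<n⇒m%n≡m t<M = refl
... | inj₂ t≡M rewrite trans ex≡t (trans (cong (_% (q ∸ 1)) t≡M) (n%n≡0 (q ∸ 1))) = sym t≡M

star-1 : ∀ q .{{_ : NonZero (q ∸ 1)}} {x} → 1 ≤ x → x ≤ q ∸ 1 → star q 1 x ≡ x
star-1 q 1≤x x≤M = star-unique q ≤-refl 1≤x 1≤x x≤M (cong (_% (q ∸ 1)) (*-identityˡ _))

-- With u = suc E: (u − 1)·D ≡ r·u − D ≡ F (mod M), because u·k = M and D ≡ r (mod k).
E*D%M≡F%M : ∀ {E D F M k r} .{{_ : NonZero k}} .{{_ : NonZero M}} → suc E * k ≡ M →
            D % k ≡ r % k → F + D ≡ M + r * suc E → (E * D) % M ≡ F % M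
E*D%M≡F%M {E} {D} {F} {M} {k} {r} refl D≡r F+D≡M+ru = begin
  (E * D) % M                    ≡⟨ [m+kn]%n≡m%n (E * D) (1 + r / k) M ⟨
  (E * D + (1 + r / k) * M) % M  ≡⟨ cong (_% M) (+-cancelʳ-≡ D _ _ shifted) ⟩
  (F + D / k * M) % M            ≡⟨ [m+kn]%n≡m%n F (D / k) M ⟩
  F % M                          ∎
  where
  open ≡-Reasoning
  ρ = D % k
  D≡ : D ≡ ρ + D / k * k
  D≡ = m≡m%n+[m/n]*n D k
  r≡ : r ≡ ρ + r / k * k
  r≡ = trans (m≡m%n+[m/n]*n r k) (cong (_+ r / k * k) (sym D≡r))
  expand : ∀ E k ρ a b → E * (ρ + a * k) + (1 + b) * (suc E * k) + (ρ + a * k)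
                         ≡ suc E * k + (ρ + b * k) * suc E + a * (suc E * k)
  expand = solve-∀
  shifted : E * D + (1 + r / k) * M + D ≡ F + D / k * M + D
  shifted = begin
    E * D + (1 + r / k) * M + D                             ≡⟨ cong (λ x → E * x + (1 + r / k) * M + x) D≡ ⟩
    E * (ρ + D / k * k) + (1 + r / k) * M + (ρ + D / k * k) ≡⟨ expand E k ρ (D / k) (r / k) ⟩
    M + (ρ + r / k * k) * suc E + D / k * M                 ≡⟨ cong (λ x → M + x * suc E + D / k * M) r≡ ⟨
    M + r * suc E + D / k * M                               ≡⟨ cong (_+ D / k * M) F+D≡M+ru ⟨
    F + D + D / k * M                                       ≡⟨ xy∙z≈xz∙y F D _ ⟩
    F + D / k * M + D                                       ∎

k+r∸d≤k : ∀ k {r d} → r ≤ d → k + r ∸ d ≤ k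
k+r∸d≤k k {r} r≤d = ≤-trans (∸-monoʳ-≤ (k + r) r≤d) (≤-reflexive (m+n∸n≡m k r))

r≤k+r∸d : ∀ k {r d} → d ≤ k → r ≤ k + r ∸ d
r≤k+r∸d k {r} d≤k = ≤-trans (≤-reflexive (sym (m+n∸m≡n k r))) (∸-monoʳ-≤ (k + r) d≤k)

star-shiftedRepunit : ∀ k m .{{_ : NonZero k}} .{{_ : NonZero (suc k ^ suc (suc m) ∸ 1)}} r
                      (d : Vector ℕ (suc (suc m))) →
                      1 ≤ r → (∀ i → r ≤ d i) → (∀ i → d i ≤ k) →
                      digitsValue (suc k) (suc (suc m)) d % k ≡ r % k →
                      star (suc k ^ suc (suc m)) (shiftedRepunit (suc k) (suc m))
                           (digitsValue (suc k) (suc (suc m)) d)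
                        ≡ digitsValue (suc k) (suc (suc m)) (λ i → k + r ∸ d i)
star-shiftedRepunit k m r d 1≤r r≤d d≤k D≡r =
  star-unique (p ^ n) (1≤shiftedRepunit p m) 1≤D 1≤F F≤M
    (E*D%M≡F%M (repunit*k≡pow∸1 k n) D≡r F+D≡M+ru)
  where
  open ≡-Reasoning
  p = suc k
  n = suc (suc m)
  u = repunit p n
  D = digitsValue p n d
  d̄ : Vector ℕ n
  d̄ i = k + r ∸ d i
  F = digitsValue p n d̄
  1≤D : 1 ≤ D
  1≤D = ≤-trans 1≤r (≤-trans (r≤d zero) (digit≤digitsValue p n d zero))
  1≤F : 1 ≤ F
  1≤F = ≤-trans 1≤r (≤-trans (r≤k+r∸d k (d≤k zero)) (digit≤digitsValue p n d̄ zero))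
  F≤M : F ≤ p ^ n ∸ 1
  F≤M = digitsValue≤pow∸1 k n d̄ (k+r∸d≤k k ∘ r≤d)
  F+D≡M+ru : F + D ≡ (p ^ n ∸ 1) + r * u
  F+D≡M+ru = begin
    F + D               ≡⟨ digitsValue-complement p n (k + r) d (λ i → ≤-trans (d≤k i) (m≤m+n k r)) ⟩
    (k + r) * u         ≡⟨ *-distribʳ-+ u k r ⟩
    k * u + r * u       ≡⟨ cong (_+ r * u) (trans (*-comm k u) (repunit*k≡pow∸1 k n)) ⟩
    (p ^ n ∸ 1) + r * u ∎

complementary-sums-dichotomy : ∀ m k r {a b} → 2 ≤ r → b + a ≡ suc m * (k + r) →
                               suc m * k + 2 < 2 * a ⊎ suc m * k + 2 * m < 2 * b
complementary-sums-dichotomy m k r {a} {b} 2≤r b+a≡ with suc m * k + 2 <? 2 * a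
... | yes large = inj₁ large
... | no  small = inj₂ (+-cancelʳ-≤ (suc m * k + 2) _ _ (begin
  suc (suc m * k + 2 * m) + (suc m * k + 2)               ≤⟨ m≤m+n _ (2 * m + 1) ⟩
  suc (suc m * k + 2 * m) + (suc m * k + 2) + (2 * m + 1) ≡⟨ regroup m k ⟩
  2 * (suc m * (k + 2))                                   ≤⟨ *-monoʳ-≤ 2 (*-monoʳ-≤ (suc m) (+-monoʳ-≤ k 2≤r)) ⟩
  2 * (suc m * (k + r))                                   ≡⟨ cong (2 *_) b+a≡ ⟨
  2 * (b + a)                                             ≡⟨ *-distribˡ-+ 2 b a ⟩
  2 * b + 2 * a                                           ≤⟨ +-monoʳ-≤ (2 * b) (≮⇒≥ small) ⟩
  2 * b + (suc m * k + 2)                                 ∎))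
  where
  open ≤-Reasoning
  regroup : ∀ m k → suc (suc m * k + 2 * m) + (suc m * k + 2) + (2 * m + 1) ≡ 2 * (suc m * (k + 2))
  regroup = solve-∀

lemma10 : (p n : ℕ) → Prime p → 2 ≤ n →
    .{{_ : NonZero (p ^ n ∸ 1)}} → .{{_ : NonZero p}} → .{{_ : NonZero (p ∸ 1)}} →
    (d : Fin n → ℕ) → (∀ i → d i < p) → ¬ (∀ i → d i ≡ p ∸ 1) →
    (r : ℕ) → 2 ≤ r → r ≤ p ∸ 1 →
    digitsValue p n d % (p ∸ 1) ≡ r % (p ∸ 1) →
    (∀ i → r ≤ d i) →
    Σ ℕ (λ e → (1 ≤ e × e ≤ p ^ n ∸ 1) ×
    (n * (p ∸ 1) + 2 * s p e < 2 * s p (star (p ^ n) e (digitsValue p n d))))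
lemma10 zero _ _ _ _ _ _ _ 2≤r r≤0 _ _ = contradiction (≤-trans 2≤r r≤0) λ ()
lemma10 p@(suc k) n@(suc (suc m)) _ (s≤s (s≤s z≤n)) d d<p _ r 2≤r r≤k D≡r r≤d =
  witness (complementary-sums-dichotomy (suc m) k r {sum d} {sum d̄} 2≤r
            (sum-complement n (k + r) d d≤k+r))
  where
  D = digitsValue p n d
  E = shiftedRepunit p (suc m)
  d̄ : Vector ℕ n
  d̄ i = k + r ∸ d i
  1<p : 1 < p
  1<p = s≤s (≤-trans (s≤s z≤n) (≤-trans 2≤r r≤k))
  1≤r : 1 ≤ r
  1≤r = ≤-trans (s≤s z≤n) 2≤r
  d≤k : ∀ i → d i ≤ k
  d≤k = s≤s⁻¹ ∘ d<p
  d≤k+r : ∀ i → d i ≤ k + r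
  d≤k+r i = ≤-trans (d≤k i) (m≤m+n k r)
  1≤D : 1 ≤ D
  1≤D = ≤-trans 1≤r (≤-trans (r≤d zero) (digit≤digitsValue p n d zero))
  D≤M : D ≤ p ^ n ∸ 1
  D≤M = digitsValue≤pow∸1 k n d d≤k
  s[1⋆D] : s p (star (p ^ n) 1 D) ≡ sum d
  s[1⋆D] = trans (cong (s p) (star-1 (p ^ n) 1≤D D≤M)) (s-digitsValue 1<p n d d<p)
  s[E⋆D] : s p (star (p ^ n) E D) ≡ sum d̄
  s[E⋆D] = trans (cong (s p) (star-shiftedRepunit k m r d 1≤r r≤d d≤k D≡r))
                 (s-digitsValue 1<p n d̄ (s≤s ∘ k+r∸d≤k k ∘ r≤d))
  witness : n * k + 2 < 2 * sum d ⊎ n * k + 2 * suc m < 2 * sum d̄ →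
            Σ ℕ (λ e → (1 ≤ e × e ≤ p ^ n ∸ 1) × (n * k + 2 * s p e < 2 * s p (star (p ^ n) e D)))
  witness (inj₁ large) = 1 , (≤-refl , ≤-trans 1≤D D≤M) ,
    subst₂ (λ a b → n * k + 2 * a < 2 * b) (sym (s-1 1<p)) (sym s[1⋆D]) large
  witness (inj₂ large) = E , (1≤shiftedRepunit p m , <⇒≤ (shiftedRepunit<pow∸1 k (suc m))) ,
    subst₂ (λ a b → n * k + 2 * a < 2 * b) (sym (s-shiftedRepunit 1<p (suc m))) (sym s[E⋆D]) large
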